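{- For any integers $m,p$ and any $(m,p)$-greedy sequence $A$, there exist an integer $q\le p$ and an $(m,q)$-greedy sequence $A'$ such that $$f(A)\le f(A')\le 28q^3-\tfrac{45}{2}q^2m+6qm^2-\tfrac12 m^3+R_0,$$ where $R_0=\max\{R_1,R_2,R_3\}$ with $R_1=\tfrac32 qm-\tfrac12 m^2-3q+m$, $R_2=-28q^2+\tfrac{33}{2}qm-\tfrac52 m^2+6q-2m$, and $R_3=-56q^2+\tfrac{63}{2}qm-\tfrac92 m^2+34q-10m-6$.
   Context: An $(m,p)$-greedy sequence is a sequence $A=(a_1,\dots,a_p)$ with $a_i\in\{1,2,3,4\}$ for all $i$, $a_1\ge a_2\ge\dots\ge a_p$, and $\sum_{i=1}^p a_i=m$. Set $a=|\{i:a_i=4\}|$, $b=|\{i:a_i\ge 3\}|$, $c=|\{i:a_i\ge 2\}|$. The value of $A$ is $f(A)=S_1(A)+S_2(A)+S_3(A)$, where $S_1(A)=b$, $S_2(A)=mb+a^2-ab-b^2+bc-a-3b$, and $$S_3(A)=\sum_{k=3}^{b}a_k\sum_{j=2}^{k-1}(a_j-1)(j-1)+\sum_{k=b+1}^{c}a_k\Big(\sum_{j=2}^{b}(a_j-1)(j-1)+\sum_{j=b+1}^{k-1}(a_j-1)b\Big)+\sum_{k=c+1}^{p}\Big(\sum_{j=2}^{b}(a_j-1)(j-1)+\sum_{j=b+1}^{c}(a_j-1)b\Big),$$ with empty sums equal to $0$. -}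

module Defs where

open import Data.Nat as ℕ using (ℕ; zero; suc; _∸_; _≥_; _≤?_)
open import Data.Integer using (ℤ; +_; _+_; _-_; _*_; _⊔_)
open import Data.List using (List; []; _∷_; length; map; upTo; foldr)
open import Data.Nat.ListAction using (sum)
open import Data.List.Relation.Unary.All using (All)
open import Data.List.Relation.Unary.Linked using (Linked)
open import Data.Product using (_×_)
open import Relation.Nullary using (yes; no)
open import Relation.Binary.PropositionalEquality using (_≡_)

-- 1-based access: at A k = a_k  (0 outside 1..length A; never used there)
at : List ℕ → ℕ → ℕ
at []       _             = 0
at (x ∷ xs) 0             = 0
at (x ∷ xs) 1             = x
at (x ∷ xs) (suc (suc k)) = at xs (suc k)

-- Σ[ lo ⋯ hi ] g  =  Σ_{k=lo}^{hi} g k   (empty sum 0 when hi < lo)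
Σ[_⋯_] : ℕ → ℕ → (ℕ → ℤ) → ℤ
Σ[ lo ⋯ hi ] g = foldr _+_ (+ 0) (map (λ i → g (lo ℕ.+ i)) (upTo (suc hi ∸ lo)))

Greedy : ℕ → ℕ → List ℕ → Set
Greedy m p A =
  length A ≡ p × All (λ x → 1 ℕ.≤ x × x ℕ.≤ 4) A × Linked _≥_ A × sum A ≡ m

count≥ : ℕ → List ℕ → ℕ
count≥ t []       = 0
count≥ t (x ∷ xs) with t ≤? x
... | yes _ = suc (count≥ t xs)
... | no  _ = count≥ t xs

module _ (m : ℕ) (A : List ℕ) where
  private
    p = length A
    a = count≥ 4 A
    b = count≥ 3 A
    c = count≥ 2 A
    aᵢ : ℕ → ℤ
    aᵢ k = + at A k
    a' b' c' m' : ℤ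
    a' = + a
    b' = + b
    c' = + c
    m' = + m
    T₁ : ℤ
    T₁ = Σ[ 2 ⋯ b ] (λ j → (aᵢ j - + 1) * + (j ∸ 1))

  S₁ S₂ S₃ f : ℤ
  S₁ = b'
  S₂ = m' * b' + a' * a' - a' * b' - b' * b' + b' * c' - a' - + 3 * b'
  S₃ = Σ[ 3 ⋯ b ] (λ k → aᵢ k * Σ[ 2 ⋯ k ∸ 1 ] (λ j → (aᵢ j - + 1) * + (j ∸ 1)))
     + Σ[ suc b ⋯ c ] (λ k → aᵢ k * (T₁ + Σ[ suc b ⋯ k ∸ 1 ] (λ j → (aᵢ j - + 1) * b')))
     + Σ[ suc c ⋯ p ] (λ k → T₁ + Σ[ suc b ⋯ c ] (λ j → (aᵢ j - + 1) * b'))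
  f = S₁ + S₂ + S₃

-- twice the upper bound:  2·(28q³ - 45/2 q²m + 6qm² - 1/2 m³ + max{R₁,R₂,R₃})
twiceBound : ℕ → ℕ → ℤ
twiceBound q m =
  + 56 * q' * q' * q' - + 45 * q' * q' * m' + + 12 * q' * m' * m' - m' * m' * m'
  + (R₁₂ ⊔ R₂₂ ⊔ R₃₂)
  where
  q' m' R₁₂ R₂₂ R₃₂ : ℤ
  q' = + q
  m' = + m
  R₁₂ = + 3 * q' * m' - m' * m' - + 6 * q' + + 2 * m'
  R₂₂ = - (+ 56) * q' * q' + + 33 * q' * m' - + 5 * m' * m' + + 12 * q' - + 4 * m'
    where open import Data.Integer using (-_)
  R₃₂ = - (+ 112) * q' * q' + + 63 * q' * m' - + 9 * m' * m' + + 68 * q' - + 20 * m' - + 12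
    where open import Data.Integer using (-_)

module Submission where

-- A greedy sequence is a run of blocks 4^x 3^y 2^z 1^w.  For such a sequence every sum in f
-- telescopes, so 2f is an explicit polynomial in m, x, y, z, w.  The moves 2+1 ↦ 3, 1+1 ↦ 2
-- and 2+2 ↦ 3+1 keep the sum m, do not lengthen the sequence, and raise 2f by twice a product
-- of natural numbers.  Applying them until none applies leaves z + w ≤ 1, and on each of
-- these three shapes 2f equals 56q³ − 45q²m + 12qm² − m³ + 2Rᵢ exactly.

open import Defs
open import Data.Nat using (ℕ; _≤_)
open import Data.Integer using (+_; _*_) renaming (_≤_ to _≤ℤ_)
open import Data.List using (List)
open import Data.Product using (Σ; _×_)

open import Function using (_∘_)
open import Data.Nat as ℕ using (zero; suc; _∸_; _<_; _≥_; s≤s; z<s; s<s; _≤?_)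
import Data.Nat.Properties as ℕₚ
open import Data.Integer using (ℤ; _+_; _-_; -_; _⊔_)
open import Data.Integer.Properties
  using (+-assoc; +-identityˡ; +-identityʳ; +-inverseʳ; *-identityˡ; *-zeroʳ; *-distribˡ-+; pos-*;
         *-commutativeSemigroup; ≤-refl; ≤-reflexive; ≤-trans; i≤i+j; +-monoʳ-≤; i≤i⊔j; i≤j⊔i; *-cancelˡ-≤-pos)
open import Algebra.Properties.CommutativeSemigroup *-commutativeSemigroup using (x∙yz≈y∙xz)
open import Data.Integer.Tactic.RingSolver using (solve-∀)
open import Data.List using ([]; _∷_; _++_; length; replicate; foldr; applyUpTo)
open import Data.List.Properties using (map-applyUpTo; length-++; length-replicate)
open import Data.Nat.ListAction using (sum)
open import Data.Nat.ListAction.Properties using (sum-++)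
open import Data.List.Relation.Unary.All using (All; []; _∷_)
open import Data.List.Relation.Unary.All.Properties using (++⁺; replicate⁺)
open import Data.List.Relation.Unary.Linked as Linked using (Linked; []; [-]; _∷_)
open import Data.Product using (∃-syntax; _,_)
open import Relation.Nullary using (Dec; yes; no)
open import Relation.Nullary.Decidable using (from-yes)
import Data.Nat.Tactic.RingSolver as ℕ-Solver
open import Relation.Binary.Construct.Closure.ReflexiveTransitive using (Star; ε; _◅_; fold)
open import Relation.Binary.PropositionalEquality

-- Finite sums

∑ : ℕ → (ℕ → ℤ) → ℤ
∑ zero    h = + 0
∑ (suc n) h = h 0 + ∑ n (h ∘ suc)

foldr-applyUpTo : ∀ n (h : ℕ → ℤ) → foldr _+_ (+ 0) (applyUpTo h n) ≡ ∑ n h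
foldr-applyUpTo zero    h = refl
foldr-applyUpTo (suc n) h = cong (_+_ (h 0)) (foldr-applyUpTo n (h ∘ suc))

Σ-as-∑ : ∀ lo hi g → Σ[ lo ⋯ hi ] g ≡ ∑ (suc hi ∸ lo) (λ i → g (lo ℕ.+ i))
Σ-as-∑ lo hi g =
  trans (cong (foldr _+_ (+ 0)) (map-applyUpTo (λ i → i) h (suc hi ∸ lo))) (foldr-applyUpTo (suc hi ∸ lo) h)
  where
  h : ℕ → ℤ
  h i = g (lo ℕ.+ i)

Σ-after : ∀ b n g → Σ[ suc b ⋯ b ℕ.+ n ] g ≡ ∑ n (λ i → g (suc (b ℕ.+ i)))
Σ-after b n g =
  trans (Σ-as-∑ (suc b) (b ℕ.+ n) g) (cong (λ k → ∑ k (λ i → g (suc (b ℕ.+ i)))) (ℕₚ.m+n∸m≡n b n))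

Σ-dropˡ-zero : ∀ lo hi g → g lo ≡ + 0 → Σ[ suc lo ⋯ hi ] g ≡ Σ[ lo ⋯ hi ] g
Σ-dropˡ-zero zero    hi      g g0≡0 = trans (Σ-as-∑ 1 hi g) (sym (begin
  Σ[ 0 ⋯ hi ] g                 ≡⟨ Σ-as-∑ 0 hi g ⟩
  g 0 + ∑ hi (g ∘ suc)          ≡⟨ cong (_+ ∑ hi (g ∘ suc)) g0≡0 ⟩
  + 0 + ∑ hi (g ∘ suc)          ≡⟨ +-identityˡ _ ⟩
  ∑ hi (g ∘ suc)                ∎))
  where open ≡-Reasoning
Σ-dropˡ-zero (suc lo) zero     g _    =
  sym (trans (Σ-as-∑ (suc lo) 0 g) (cong (λ k → ∑ k (λ i → g (suc lo ℕ.+ i))) (ℕₚ.0∸n≡0 lo)))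
Σ-dropˡ-zero (suc lo) (suc hi) g g0≡0 = Σ-dropˡ-zero lo hi (g ∘ suc) g0≡0

∑-cong : ∀ n {h h′ : ℕ → ℤ} → (∀ i → i < n → h i ≡ h′ i) → ∑ n h ≡ ∑ n h′
∑-cong zero    eq = refl
∑-cong (suc n) eq = cong₂ _+_ (eq 0 z<s) (∑-cong n (λ i i<n → eq (suc i) (s<s i<n)))

∑-+ : ∀ m n h → ∑ (m ℕ.+ n) h ≡ ∑ m h + ∑ n (λ i → h (m ℕ.+ i))
∑-+ zero    n h = sym (+-identityˡ _)
∑-+ (suc m) n h = trans (cong (_+_ (h 0)) (∑-+ m n (h ∘ suc))) (sym (+-assoc (h 0) _ _))

∑-const : ∀ n c → ∑ n (λ _ → c) ≡ + n * c
∑-const zero    c = refl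
∑-const (suc n) c = trans (cong (_+_ c) (∑-const n c)) (expand c (+ n))
  where
  expand : ∀ c N → c + N * c ≡ (+ 1 + N) * c
  expand = solve-∀

∑-telescope : ∀ n {d : ℤ} {h : ℕ → ℤ} (G : ℕ → ℤ) →
  (∀ i → i < n → d * h i ≡ G (suc i) - G i) → d * ∑ n h ≡ G n - G 0
∑-telescope zero    {d} G _    = trans (*-zeroʳ d) (sym (+-inverseʳ (G 0)))
∑-telescope (suc n) {d} {h} G step = begin
  d * (h 0 + ∑ n (h ∘ suc))            ≡⟨ *-distribˡ-+ d _ _ ⟩
  d * h 0 + d * ∑ n (h ∘ suc)          ≡⟨ cong₂ _+_ (step 0 z<s) rest ⟩
  (G 1 - G 0) + (G (suc n) - G 1)      ≡⟨ cancel (G 0) (G 1) (G (suc n)) ⟩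
  G (suc n) - G 0                      ∎
  where
  open ≡-Reasoning
  rest : d * ∑ n (h ∘ suc) ≡ G (suc n) - G 1
  rest = ∑-telescope n {d} {h ∘ suc} (G ∘ suc) (λ i i<n → step (suc i) (s<s i<n))
  cancel : ∀ a b c → (b - a) + (c - b) ≡ c - a
  cancel = solve-∀

-- Block sequences 4^x 3^y 2^z 1^w

record Blocks : Set where
  constructor ⟨_,_,_,_⟩
  field
    fours threes twos ones : ℕ
open Blocks

block : Blocks → List ℕ
block ⟨ x , y , z , w ⟩ = replicate x 4 ++ replicate y 3 ++ replicate z 2 ++ replicate w 1

-- INLINE lets the ring solvers see through weight, size and the polynomials below.
weight : Blocks → ℕ
weight s = 4 ℕ.* fours s ℕ.+ 3 ℕ.* threes s ℕ.+ 2 ℕ.* twos s ℕ.+ ones s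
{-# INLINE weight #-}

size : Blocks → ℕ
size s = fours s ℕ.+ threes s ℕ.+ twos s ℕ.+ ones s
{-# INLINE size #-}

at-replicate-++ : ∀ n {v} R {i} → i < n → at (replicate n v ++ R) (suc i) ≡ v
at-replicate-++ (suc n) R {zero}  _         = refl
at-replicate-++ (suc n) R {suc i} (s<s i<n) = at-replicate-++ n R i<n

at-after-replicate : ∀ n {v} R i → at (replicate n v ++ R) (suc (n ℕ.+ i)) ≡ at R (suc i)
at-after-replicate zero    R i = refl
at-after-replicate (suc n) R i = at-after-replicate n R i

module _ {x y z w : ℕ} where

  at-block-fours : ∀ {i} → i < x → at (block ⟨ x , y , z , w ⟩) (suc i) ≡ 4
  at-block-fours = at-replicate-++ x _

  at-block-threes : ∀ {i} → i < y → at (block ⟨ x , y , z , w ⟩) (suc (x ℕ.+ i)) ≡ 3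
  at-block-threes {i} i<y = trans (at-after-replicate x _ i) (at-replicate-++ y _ i<y)

  at-block-twos : ∀ {i} → i < z → at (block ⟨ x , y , z , w ⟩) (suc (x ℕ.+ y ℕ.+ i)) ≡ 2
  at-block-twos {i} i<z = begin
    at (block ⟨ x , y , z , w ⟩) (suc (x ℕ.+ y ℕ.+ i))   ≡⟨ cong (λ k → at (block ⟨ x , y , z , w ⟩) (suc k))
                                                                 (ℕₚ.+-assoc x y i) ⟩
    at (block ⟨ x , y , z , w ⟩) (suc (x ℕ.+ (y ℕ.+ i))) ≡⟨ at-after-replicate x _ (y ℕ.+ i) ⟩
    at (block ⟨ 0 , y , z , w ⟩) (suc (y ℕ.+ i))         ≡⟨ at-after-replicate y _ i ⟩
    at (block ⟨ 0 , 0 , z , w ⟩) (suc i)                 ≡⟨ at-replicate-++ z _ i<z ⟩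
    2                                                    ∎
    where open ≡-Reasoning

additive-on-block : (h : List ℕ → ℕ) (c : ℕ → ℕ) →
  (∀ xs ys → h (xs ++ ys) ≡ h xs ℕ.+ h ys) → (∀ n v → h (replicate n v) ≡ n ℕ.* c v) →
  ∀ x y z w → h (block ⟨ x , y , z , w ⟩) ≡ x ℕ.* c 4 ℕ.+ (y ℕ.* c 3 ℕ.+ (z ℕ.* c 2 ℕ.+ w ℕ.* c 1))
additive-on-block h c h-++ h-replicate x y z w =
  trans (h-++ (replicate x 4) _) (cong₂ ℕ._+_ (h-replicate x 4)
  (trans (h-++ (replicate y 3) _) (cong₂ ℕ._+_ (h-replicate y 3)
  (trans (h-++ (replicate z 2) _) (cong₂ ℕ._+_ (h-replicate z 2) (h-replicate w 1))))))

sum-replicate : ∀ n v → sum (replicate n v) ≡ n ℕ.* v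
sum-replicate zero    v = refl
sum-replicate (suc n) v = cong (v ℕ.+_) (sum-replicate n v)

count≥-++ : ∀ t xs ys → count≥ t (xs ++ ys) ≡ count≥ t xs ℕ.+ count≥ t ys
count≥-++ t []       ys = refl
count≥-++ t (x ∷ xs) ys with t ≤? x
... | yes _ = cong suc (count≥-++ t xs ys)
... | no  _ = count≥-++ t xs ys

indicator : ∀ {p} {P : Set p} → Dec P → ℕ
indicator (yes _) = 1
indicator (no  _) = 0

count≥-replicate : ∀ t n v → count≥ t (replicate n v) ≡ n ℕ.* indicator (t ≤? v)
count≥-replicate t zero    v = refl
count≥-replicate t (suc n) v with t ≤? v | count≥-replicate t n v
... | yes _ | ih = cong suc ih
... | no  _ | ih = ih

sum-block : ∀ s → sum (block s) ≡ weight s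
sum-block ⟨ x , y , z , w ⟩ =
  trans (additive-on-block sum (λ v → v) sum-++ sum-replicate x y z w) (rearrange x y z w)
  where
  rearrange : ∀ x y z w →
    x ℕ.* 4 ℕ.+ (y ℕ.* 3 ℕ.+ (z ℕ.* 2 ℕ.+ w ℕ.* 1)) ≡ 4 ℕ.* x ℕ.+ 3 ℕ.* y ℕ.+ 2 ℕ.* z ℕ.+ w
  rearrange = ℕ-Solver.solve-∀

length-block : ∀ s → length (block s) ≡ size s
length-block ⟨ x , y , z , w ⟩ =
  trans (additive-on-block length (λ _ → 1) (λ xs _ → length-++ xs) length-replicate′ x y z w)
        (rearrange x y z w)
  where
  length-replicate′ : ∀ n v → length (replicate n v) ≡ n ℕ.* 1
  length-replicate′ n v = trans (length-replicate n) (sym (ℕₚ.*-identityʳ n))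
  rearrange : ∀ x y z w → x ℕ.* 1 ℕ.+ (y ℕ.* 1 ℕ.+ (z ℕ.* 1 ℕ.+ w ℕ.* 1)) ≡ x ℕ.+ y ℕ.+ z ℕ.+ w
  rearrange = ℕ-Solver.solve-∀

module _ (x y z w : ℕ) where
  private
    count≥-block : ∀ t → count≥ t (block ⟨ x , y , z , w ⟩) ≡
      x ℕ.* indicator (t ≤? 4) ℕ.+ (y ℕ.* indicator (t ≤? 3) ℕ.+
        (z ℕ.* indicator (t ≤? 2) ℕ.+ w ℕ.* indicator (t ≤? 1)))
    count≥-block t =
      additive-on-block (count≥ t) (λ v → indicator (t ≤? v)) (count≥-++ t) (count≥-replicate t) x y z w

  count≥4-block : count≥ 4 (block ⟨ x , y , z , w ⟩) ≡ x
  count≥4-block = trans (count≥-block 4) (rearrange x y z w)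
    where
    rearrange : ∀ x y z w → x ℕ.* 1 ℕ.+ (y ℕ.* 0 ℕ.+ (z ℕ.* 0 ℕ.+ w ℕ.* 0)) ≡ x
    rearrange = ℕ-Solver.solve-∀

  count≥3-block : count≥ 3 (block ⟨ x , y , z , w ⟩) ≡ x ℕ.+ y
  count≥3-block = trans (count≥-block 3) (rearrange x y z w)
    where
    rearrange : ∀ x y z w → x ℕ.* 1 ℕ.+ (y ℕ.* 1 ℕ.+ (z ℕ.* 0 ℕ.+ w ℕ.* 0)) ≡ x ℕ.+ y
    rearrange = ℕ-Solver.solve-∀

  count≥2-block : count≥ 2 (block ⟨ x , y , z , w ⟩) ≡ x ℕ.+ y ℕ.+ z
  count≥2-block = trans (count≥-block 2) (rearrange x y z w)
    where
    rearrange : ∀ x y z w → x ℕ.* 1 ℕ.+ (y ℕ.* 1 ℕ.+ (z ℕ.* 1 ℕ.+ w ℕ.* 0)) ≡ x ℕ.+ y ℕ.+ z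
    rearrange = ℕ-Solver.solve-∀

descending-replicate : ∀ n {v} → Linked _≥_ (replicate n v)
descending-replicate zero          = []
descending-replicate (suc zero)    = [-]
descending-replicate (suc (suc n)) = ℕₚ.≤-refl ∷ descending-replicate (suc n)

descending-replicate-++ : ∀ n {v R} → All (_≤ v) R → Linked _≥_ R → Linked _≥_ (replicate n v ++ R)
descending-replicate-++ zero                      _         R↓ = R↓
descending-replicate-++ (suc zero)    {R = []}    _         _  = [-]
descending-replicate-++ (suc zero)    {R = _ ∷ _} (u≤v ∷ _) R↓ = u≤v ∷ R↓
descending-replicate-++ (suc (suc n))             R≤v       R↓ =
  ℕₚ.≤-refl ∷ descending-replicate-++ (suc n) R≤v R↓

block-descending : ∀ s → Linked _≥_ (block s)
block-descending ⟨ x , y , z , w ⟩ =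
  descending-replicate-++ x
    (++⁺ (replicate⁺ y (from-yes (3 ≤? 4))) (++⁺ (replicate⁺ z (from-yes (2 ≤? 4))) (replicate⁺ w (from-yes (1 ≤? 4)))))
  (descending-replicate-++ y (++⁺ (replicate⁺ z (from-yes (2 ≤? 3))) (replicate⁺ w (from-yes (1 ≤? 3))))
  (descending-replicate-++ z (replicate⁺ w (from-yes (1 ≤? 2)))
  (descending-replicate w)))

InRange : ℕ → Set
InRange v = 1 ≤ v × v ≤ 4

block-in-range : ∀ s → All InRange (block s)
block-in-range ⟨ x , y , z , w ⟩ =
  ++⁺ (replicate⁺ x (from-yes (1 ≤? 4) , from-yes (4 ≤? 4)))
  (++⁺ (replicate⁺ y (from-yes (1 ≤? 3) , from-yes (3 ≤? 4)))
  (++⁺ (replicate⁺ z (from-yes (1 ≤? 2) , from-yes (2 ≤? 4)))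
       (replicate⁺ w (from-yes (1 ≤? 1) , from-yes (1 ≤? 4)))))

block-greedy : ∀ s → Greedy (weight s) (size s) (block s)
block-greedy s = length-block s , block-in-range s , block-descending s , sum-block s

∷-block : ∀ v s → InRange v → Linked _≥_ (v ∷ block s) → ∃[ s′ ] v ∷ block s ≡ block s′
∷-block 0 _ (() , _) _
∷-block 1 ⟨ 0 , 0 , 0 , w ⟩     _ _               = ⟨ 0 , 0 , 0 , suc w ⟩ , refl
∷-block 1 ⟨ 0 , 0 , suc z , w ⟩ _ (s≤s () ∷ _)
∷-block 1 ⟨ 0 , suc y , z , w ⟩ _ (s≤s () ∷ _)
∷-block 1 ⟨ suc x , y , z , w ⟩ _ (s≤s () ∷ _)
∷-block 2 ⟨ 0 , 0 , z , w ⟩     _ _               = ⟨ 0 , 0 , suc z , w ⟩ , refl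
∷-block 2 ⟨ 0 , suc y , z , w ⟩ _ (s≤s (s≤s ()) ∷ _)
∷-block 2 ⟨ suc x , y , z , w ⟩ _ (s≤s (s≤s ()) ∷ _)
∷-block 3 ⟨ 0 , y , z , w ⟩     _ _               = ⟨ 0 , suc y , z , w ⟩ , refl
∷-block 3 ⟨ suc x , y , z , w ⟩ _ (s≤s (s≤s (s≤s ())) ∷ _)
∷-block 4 ⟨ x , y , z , w ⟩     _ _               = ⟨ suc x , y , z , w ⟩ , refl
∷-block (suc (suc (suc (suc (suc _))))) _ (_ , s≤s (s≤s (s≤s (s≤s ())))) _

descending⇒block : ∀ {A} → All InRange A → Linked _≥_ A → ∃[ s ] A ≡ block s
descending⇒block []        _  = ⟨ 0 , 0 , 0 , 0 ⟩ , refl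
descending⇒block (v∈ ∷ A∈) A↓ with descending⇒block A∈ (Linked.tail A↓)
... | s , refl = ∷-block _ s v∈ A↓

-- The value f of a block sequence

module Entries (A : List ℕ) where

  a[_] : ℕ → ℤ
  a[ k ] = + at A k

  U : ℕ → ℤ
  U n = Σ[ 2 ⋯ n ] (λ j → (a[ j ] - + 1) * + (j ∸ 1))

  V : ℕ → ℕ → ℤ
  V b n = Σ[ suc b ⋯ n ] (λ j → (a[ j ] - + 1) * + b)

  -- f m A unfolds to fWithCounts m (count≥ 4 A) (count≥ 3 A) (count≥ 2 A) (length A).
  fWithCounts : ℕ → ℕ → ℕ → ℕ → ℕ → ℤ
  fWithCounts m a b c p =
    + b + (+ m * + b + + a * + a - + a * + b - + b * + b + + b * + c - + a - + 3 * + b)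
    + (Σ[ 3 ⋯ b ] (λ k → a[ k ] * U (k ∸ 1))
       + Σ[ suc b ⋯ c ] (λ k → a[ k ] * (U b + V b (k ∸ 1)))
       + Σ[ suc c ⋯ p ] (λ _ → U b + V b c))

twiceU : ℤ → ℤ → ℤ
twiceU X Y = + 3 * X * (X - + 1) + + 4 * X * Y + + 2 * Y * (Y - + 1)
{-# INLINE twiceU #-}

twiceFirstSum : ℤ → ℤ → ℤ
twiceFirstSum X Y =
  + 4 * X * (X - + 1) * (X - + 2) + + 9 * X * (X - + 1) * Y + + 6 * X * Y * (Y - + 1) + + 2 * Y * (Y - + 1) * (Y - + 2)
{-# INLINE twiceFirstSum #-}

twiceSecondSum : ℤ → ℤ → ℤ → ℤ
twiceSecondSum X Y Z = + 2 * Z * twiceU X Y + + 2 * (X + Y) * Z * (Z - + 1)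
{-# INLINE twiceSecondSum #-}

twiceThirdSum : ℤ → ℤ → ℤ → ℤ → ℤ
twiceThirdSum X Y Z W = W * (twiceU X Y + + 2 * Z * (X + Y))
{-# INLINE twiceThirdSum #-}

twiceF : ℤ → ℤ → ℤ → ℤ → ℤ → ℤ
twiceF M X Y Z W =
  + 2 * (X + Y + (M * (X + Y) + X * X - X * (X + Y) - (X + Y) * (X + Y) + (X + Y) * (X + Y + Z) - X - + 3 * (X + Y)))
  + twiceFirstSum X Y + twiceSecondSum X Y Z + twiceThirdSum X Y Z W
{-# INLINE twiceF #-}

module BlockSums (x y z w : ℕ) where

  open Entries (block ⟨ x , y , z , w ⟩)
  open ≡-Reasoning

  private
    X Y Z W : ℤ
    X = + x
    Y = + y
    Z = + z
    W = + w
    b : ℕ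
    b = x ℕ.+ y

  a-fours : ∀ {i} → i < x → a[ suc i ] ≡ + 4
  a-fours i<x = cong +_ (at-block-fours {x} {y} {z} {w} i<x)

  a-threes : ∀ {i} → i < y → a[ suc (x ℕ.+ i) ] ≡ + 3
  a-threes i<y = cong +_ (at-block-threes {x} {y} {z} {w} i<y)

  a-twos : ∀ {i} → i < z → a[ suc (b ℕ.+ i) ] ≡ + 2
  a-twos i<z = cong +_ (at-block-twos {x} {y} {z} {w} i<z)

  U-as-∑ : ∀ n → U n ≡ ∑ n (λ i → (a[ suc i ] - + 1) * + i)
  U-as-∑ n = trans (Σ-dropˡ-zero 1 n g (*-zeroʳ (a[ 1 ] - + 1))) (Σ-as-∑ 1 n g)
    where
    g : ℕ → ℤ
    g j = (a[ j ] - + 1) * + (j ∸ 1)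

  twice-U-fours : ∀ {i} → i ≤ x → + 2 * U i ≡ + 3 * + i * (+ i - + 1)
  twice-U-fours {i} i≤x = begin
    + 2 * U i                                       ≡⟨ cong (_*_ (+ 2)) (U-as-∑ i) ⟩
    + 2 * ∑ i (λ j → (a[ suc j ] - + 1) * + j)      ≡⟨ ∑-telescope i {+ 2} (G ∘ +_) step ⟩
    G (+ i) - G (+ 0)                               ≡⟨ +-identityʳ _ ⟩
    + 3 * + i * (+ i - + 1)                         ∎
    where
    G : ℤ → ℤ
    G N = + 3 * N * (N - + 1)
    {-# INLINE G #-}
    difference : ∀ J → + 2 * ((+ 4 - + 1) * J) ≡ G (+ 1 + J) - G J
    difference = solve-∀
    step : ∀ j → j < i → + 2 * ((a[ suc j ] - + 1) * + j) ≡ G (+ suc j) - G (+ j)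
    step j j<i = trans (cong (λ v → + 2 * ((v - + 1) * + j)) (a-fours (ℕₚ.<-≤-trans j<i i≤x)))
                       (difference (+ j))

  twice-U-threes : ∀ {i} → i ≤ y → + 2 * U (x ℕ.+ i) ≡ twiceU X (+ i)
  twice-U-threes {i} i≤y = begin
    + 2 * U (x ℕ.+ i)                               ≡⟨ cong (_*_ (+ 2)) (trans (U-as-∑ (x ℕ.+ i)) (∑-+ x i h)) ⟩
    + 2 * (∑ x h + ∑ i (λ j → h (x ℕ.+ j)))         ≡⟨ *-distribˡ-+ (+ 2) (∑ x h) _ ⟩
    + 2 * ∑ x h + + 2 * ∑ i (λ j → h (x ℕ.+ j))     ≡⟨ cong₂ _+_
                                                           (trans (cong (_*_ (+ 2)) (sym (U-as-∑ x))) (twice-U-fours ℕₚ.≤-refl))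
                                                           (∑-telescope i {+ 2} (G X ∘ +_) step) ⟩
    + 3 * X * (X - + 1) + (G X (+ i) - G X (+ 0))   ≡⟨ close X (+ i) ⟩
    twiceU X (+ i)                                  ∎
    where
    h : ℕ → ℤ
    h j = (a[ suc j ] - + 1) * + j
    G : ℤ → ℤ → ℤ
    G X N = + 4 * X * N + + 2 * N * (N - + 1)
    {-# INLINE G #-}
    difference : ∀ X J → + 2 * ((+ 3 - + 1) * (X + J)) ≡ G X (+ 1 + J) - G X J
    difference = solve-∀
    close : ∀ X I → + 3 * X * (X - + 1) + (G X I - G X (+ 0)) ≡ twiceU X I
    close = solve-∀
    step : ∀ j → j < i → + 2 * h (x ℕ.+ j) ≡ G X (+ suc j) - G X (+ j)
    step j j<i = trans (cong (λ v → + 2 * ((v - + 1) * + (x ℕ.+ j))) (a-threes (ℕₚ.<-≤-trans j<i i≤y)))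
                       (difference X (+ j))

  twice-first-sum : + 2 * Σ[ 3 ⋯ b ] (λ k → a[ k ] * U (k ∸ 1)) ≡ twiceFirstSum X Y
  twice-first-sum = begin
    + 2 * Σ[ 3 ⋯ b ] g                               ≡⟨ cong (_*_ (+ 2)) (trans (Σ-dropˡ-zero 2 b g (*-zeroʳ a[ 2 ]))
                                                                         (trans (Σ-dropˡ-zero 1 b g (*-zeroʳ a[ 1 ]))
                                                                         (trans (Σ-as-∑ 1 b g) (∑-+ x y h)))) ⟩
    + 2 * (∑ x h + ∑ y (λ i → h (x ℕ.+ i)))          ≡⟨ *-distribˡ-+ (+ 2) (∑ x h) _ ⟩
    + 2 * ∑ x h + + 2 * ∑ y (λ i → h (x ℕ.+ i))      ≡⟨ cong₂ _+_ (∑-telescope x {+ 2} (G₄ ∘ +_) step₄)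
                                                                  (∑-telescope y {+ 2} (G₃ X ∘ +_) step₃) ⟩
    (G₄ X - G₄ (+ 0)) + (G₃ X Y - G₃ X (+ 0))        ≡⟨ close X Y ⟩
    twiceFirstSum X Y                                ∎
    where
    g h : ℕ → ℤ
    g k = a[ k ] * U (k ∸ 1)
    h i = a[ suc i ] * U i
    G₄ : ℤ → ℤ
    G₄ N = + 4 * N * (N - + 1) * (N - + 2)
    {-# INLINE G₄ #-}
    G₃ : ℤ → ℤ → ℤ
    G₃ X N = + 9 * X * (X - + 1) * N + + 6 * X * N * (N - + 1) + + 2 * N * (N - + 1) * (N - + 2)
    {-# INLINE G₃ #-}
    difference₄ : ∀ J → + 4 * (+ 3 * J * (J - + 1)) ≡ G₄ (+ 1 + J) - G₄ J
    difference₄ = solve-∀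
    difference₃ : ∀ X J → + 3 * twiceU X J ≡ G₃ X (+ 1 + J) - G₃ X J
    difference₃ = solve-∀
    close : ∀ X Y → (G₄ X - G₄ (+ 0)) + (G₃ X Y - G₃ X (+ 0)) ≡ twiceFirstSum X Y
    close = solve-∀
    step₄ : ∀ j → j < x → + 2 * h j ≡ G₄ (+ suc j) - G₄ (+ j)
    step₄ j j<x = begin
      + 2 * (a[ suc j ] * U j)      ≡⟨ cong (λ v → + 2 * (v * U j)) (a-fours j<x) ⟩
      + 2 * (+ 4 * U j)             ≡⟨ x∙yz≈y∙xz (+ 2) (+ 4) (U j) ⟩
      + 4 * (+ 2 * U j)             ≡⟨ cong (_*_ (+ 4)) (twice-U-fours (ℕₚ.<⇒≤ j<x)) ⟩
      + 4 * (+ 3 * + j * (+ j - + 1)) ≡⟨ difference₄ (+ j) ⟩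
      G₄ (+ suc j) - G₄ (+ j)       ∎
    step₃ : ∀ j → j < y → + 2 * h (x ℕ.+ j) ≡ G₃ X (+ suc j) - G₃ X (+ j)
    step₃ j j<y = begin
      + 2 * (a[ suc (x ℕ.+ j) ] * U (x ℕ.+ j))  ≡⟨ cong (λ v → + 2 * (v * U (x ℕ.+ j))) (a-threes j<y) ⟩
      + 2 * (+ 3 * U (x ℕ.+ j))                 ≡⟨ x∙yz≈y∙xz (+ 2) (+ 3) (U (x ℕ.+ j)) ⟩
      + 3 * (+ 2 * U (x ℕ.+ j))                 ≡⟨ cong (_*_ (+ 3)) (twice-U-threes (ℕₚ.<⇒≤ j<y)) ⟩
      + 3 * twiceU X (+ j)                      ≡⟨ difference₃ X (+ j) ⟩
      G₃ X (+ suc j) - G₃ X (+ j)               ∎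

  V-twos : ∀ {i} → i ≤ z → V b (b ℕ.+ i) ≡ + i * + b
  V-twos {i} i≤z = begin
    V b (b ℕ.+ i)                                    ≡⟨ Σ-after b i (λ j → (a[ j ] - + 1) * + b) ⟩
    ∑ i (λ j → (a[ suc (b ℕ.+ j) ] - + 1) * + b)     ≡⟨ ∑-cong i (λ j j<i → cong (λ v → (v - + 1) * + b)
                                                                                 (a-twos (ℕₚ.<-≤-trans j<i i≤z))) ⟩
    ∑ i (λ _ → + 1 * + b)                            ≡⟨ ∑-const i (+ 1 * + b) ⟩
    + i * (+ 1 * + b)                                ≡⟨ cong (_*_ (+ i)) (*-identityˡ (+ b)) ⟩
    + i * + b                                        ∎

  twice-second-sum : + 2 * Σ[ suc b ⋯ b ℕ.+ z ] (λ k → a[ k ] * (U b + V b (k ∸ 1))) ≡ twiceSecondSum X Y Z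
  twice-second-sum = begin
    + 2 * Σ[ suc b ⋯ b ℕ.+ z ] (λ k → a[ k ] * (U b + V b (k ∸ 1)))
      ≡⟨ cong (_*_ (+ 2)) (Σ-after b z (λ k → a[ k ] * (U b + V b (k ∸ 1)))) ⟩
    + 2 * ∑ z h
      ≡⟨ ∑-telescope z {+ 2} (G (+ b) (+ 2 * U b) ∘ +_) step ⟩
    G (+ b) (+ 2 * U b) Z - G (+ b) (+ 2 * U b) (+ 0)
      ≡⟨ cong (λ T → G (+ b) T Z - G (+ b) T (+ 0)) (twice-U-threes ℕₚ.≤-refl) ⟩
    G (X + Y) (twiceU X Y) Z - G (X + Y) (twiceU X Y) (+ 0)
      ≡⟨ close X Y Z ⟩
    twiceSecondSum X Y Z
      ∎
    where
    h : ℕ → ℤ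
    h i = a[ suc (b ℕ.+ i) ] * (U b + V b (b ℕ.+ i))
    G : ℤ → ℤ → ℤ → ℤ
    G B T N = + 2 * N * T + + 2 * B * N * (N - + 1)
    {-# INLINE G #-}
    difference : ∀ B u J → + 2 * (+ 2 * (u + J * B)) ≡ G B (+ 2 * u) (+ 1 + J) - G B (+ 2 * u) J
    difference = solve-∀
    close : ∀ X Y Z → G (X + Y) (twiceU X Y) Z - G (X + Y) (twiceU X Y) (+ 0) ≡ twiceSecondSum X Y Z
    close = solve-∀
    step : ∀ j → j < z → + 2 * h j ≡ G (+ b) (+ 2 * U b) (+ suc j) - G (+ b) (+ 2 * U b) (+ j)
    step j j<z = begin
      + 2 * (a[ suc (b ℕ.+ j) ] * (U b + V b (b ℕ.+ j)))   ≡⟨ cong₂ (λ v e → + 2 * (v * (U b + e)))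
                                                                     (a-twos j<z) (V-twos (ℕₚ.<⇒≤ j<z)) ⟩
      + 2 * (+ 2 * (U b + + j * + b))                     ≡⟨ difference (+ b) (U b) (+ j) ⟩
      G (+ b) (+ 2 * U b) (+ suc j) - G (+ b) (+ 2 * U b) (+ j) ∎

  twice-third-sum : + 2 * Σ[ suc (b ℕ.+ z) ⋯ b ℕ.+ z ℕ.+ w ] (λ _ → U b + V b (b ℕ.+ z)) ≡ twiceThirdSum X Y Z W
  twice-third-sum = begin
    + 2 * Σ[ suc (b ℕ.+ z) ⋯ b ℕ.+ z ℕ.+ w ] (λ _ → U b + V b (b ℕ.+ z))
      ≡⟨ cong (_*_ (+ 2)) (trans (Σ-after (b ℕ.+ z) w (λ _ → U b + V b (b ℕ.+ z)))
                                 (∑-const w (U b + V b (b ℕ.+ z)))) ⟩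
    + 2 * (W * (U b + V b (b ℕ.+ z)))
      ≡⟨ cong (λ e → + 2 * (W * (U b + e))) (V-twos ℕₚ.≤-refl) ⟩
    + 2 * (W * (U b + Z * + b))
      ≡⟨ regroup W (U b) Z (+ b) ⟩
    W * (+ 2 * U b + + 2 * Z * + b)
      ≡⟨ cong (λ T → W * (T + + 2 * Z * + b)) (twice-U-threes ℕₚ.≤-refl) ⟩
    twiceThirdSum X Y Z W
      ∎
    where
    regroup : ∀ W u Z B → + 2 * (W * (u + Z * B)) ≡ W * (+ 2 * u + + 2 * Z * B)
    regroup = solve-∀

  twice-fWithCounts : ∀ m {a b′ c p} → a ≡ x → b′ ≡ b → c ≡ b ℕ.+ z → p ≡ b ℕ.+ z ℕ.+ w →
    + 2 * fWithCounts m a b′ c p ≡ twiceF (+ m) X Y Z W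
  twice-fWithCounts m refl refl refl refl = trans (distribute S₁₂ _ _ _)
    (cong₂ _+_ (cong₂ _+_ (cong (_+_ (+ 2 * S₁₂)) twice-first-sum) twice-second-sum) twice-third-sum)
    where
    S₁₂ : ℤ
    S₁₂ = + b + (+ m * + b + X * X - X * + b - + b * + b + + b * + (b ℕ.+ z) - X - + 3 * + b)
    distribute : ∀ P s₁ s₂ s₃ → + 2 * (P + (s₁ + s₂ + s₃)) ≡ + 2 * P + + 2 * s₁ + + 2 * s₂ + + 2 * s₃
    distribute = solve-∀

twice-f-block : ∀ m x y z w → + 2 * f m (block ⟨ x , y , z , w ⟩) ≡ twiceF (+ m) (+ x) (+ y) (+ z) (+ w)
twice-f-block m x y z w = begin
  + 2 * f m A
    ≡⟨⟩
  + 2 * fWithCounts m (count≥ 4 A) (count≥ 3 A) (count≥ 2 A) (length A)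
    ≡⟨ BlockSums.twice-fWithCounts x y z w m (count≥4-block x y z w) (count≥3-block x y z w)
                                             (count≥2-block x y z w) (length-block ⟨ x , y , z , w ⟩) ⟩
  twiceF (+ m) (+ x) (+ y) (+ z) (+ w)
    ∎
  where
  A : List ℕ
  A = block ⟨ x , y , z , w ⟩
  open Entries A
  open ≡-Reasoning

twiceValueℤ : ℤ → ℤ → ℤ → ℤ → ℤ
twiceValueℤ X Y Z W = twiceF (+ 4 * X + + 3 * Y + + 2 * Z + W) X Y Z W
{-# INLINE twiceValueℤ #-}

twiceValue : Blocks → ℤ
twiceValue ⟨ x , y , z , w ⟩ = twiceValueℤ (+ x) (+ y) (+ z) (+ w)

weightℤ : Blocks → ℤ
weightℤ s = + 4 * + fours s + + 3 * + threes s + + 2 * + twos s + + ones s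
{-# INLINE weightℤ #-}

pos-weight : ∀ s → + weight s ≡ weightℤ s
pos-weight s = cong₂ _+_ (cong₂ _+_ (cong₂ _+_ (pos-* 4 (fours s)) (pos-* 3 (threes s))) (pos-* 2 (twos s))) refl

twice-f-weight : ∀ s → + 2 * f (weight s) (block s) ≡ twiceValue s
twice-f-weight s@(⟨ x , y , z , w ⟩) =
  trans (twice-f-block (weight s) x y z w) (cong (λ M → twiceF M (+ x) (+ y) (+ z) (+ w)) (pos-weight s))

-- Moves

infix 4 _⟶_ _⟶*_
data _⟶_ : Blocks → Blocks → Set where
  2+1↦3   : ∀ {x y z w} → ⟨ x , y , suc z , suc w ⟩ ⟶ ⟨ x , suc y , z , w ⟩
  1+1↦2   : ∀ {x y z w} → ⟨ x , y , z , suc (suc w) ⟩ ⟶ ⟨ x , y , suc z , w ⟩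
  2+2↦3+1 : ∀ {x y z w} → ⟨ x , y , suc (suc z) , w ⟩ ⟶ ⟨ x , suc y , z , suc w ⟩

_⟶*_ : Blocks → Blocks → Set
_⟶*_ = Star _⟶_

⟶-weight : ∀ {s t} → s ⟶ t → weight s ≡ weight t
⟶-weight (2+1↦3 {x} {y} {z} {w}) = identity x y z w
  where
  identity : ∀ x y z w → weight ⟨ x , y , suc z , suc w ⟩ ≡ weight ⟨ x , suc y , z , w ⟩
  identity = ℕ-Solver.solve-∀
⟶-weight (1+1↦2 {x} {y} {z} {w}) = identity x y z w
  where
  identity : ∀ x y z w → weight ⟨ x , y , z , suc (suc w) ⟩ ≡ weight ⟨ x , y , suc z , w ⟩
  identity = ℕ-Solver.solve-∀
⟶-weight (2+2↦3+1 {x} {y} {z} {w}) = identity x y z w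
  where
  identity : ∀ x y z w → weight ⟨ x , y , suc (suc z) , w ⟩ ≡ weight ⟨ x , suc y , z , suc w ⟩
  identity = ℕ-Solver.solve-∀

⟶-size : ∀ {s t} → s ⟶ t → size t ≤ size s
⟶-size (2+1↦3 {x} {y} {z} {w}) = ℕₚ.≤-trans (ℕₚ.n≤1+n _) (ℕₚ.≤-reflexive (identity x y z w))
  where
  identity : ∀ x y z w → suc (size ⟨ x , suc y , z , w ⟩) ≡ size ⟨ x , y , suc z , suc w ⟩
  identity = ℕ-Solver.solve-∀
⟶-size (1+1↦2 {x} {y} {z} {w}) = ℕₚ.≤-trans (ℕₚ.n≤1+n _) (ℕₚ.≤-reflexive (identity x y z w))
  where
  identity : ∀ x y z w → suc (size ⟨ x , y , suc z , w ⟩) ≡ size ⟨ x , y , z , suc (suc w) ⟩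
  identity = ℕ-Solver.solve-∀
⟶-size (2+2↦3+1 {x} {y} {z} {w}) = ℕₚ.≤-reflexive (identity x y z w)
  where
  identity : ∀ x y z w → size ⟨ x , suc y , z , suc w ⟩ ≡ size ⟨ x , y , suc (suc z) , w ⟩
  identity = ℕ-Solver.solve-∀

-- Opaque, so that case analyses using these identities never unfold the solver's proof terms.
opaque
  twiceValue-2+1↦3 : ∀ X Y Z W →
    twiceValueℤ X (+ 1 + Y) Z W ≡ twiceValueℤ X Y (+ 1 + Z) (+ 1 + W) + + 2 * ((X + Y + Z + + 1) * (Z + W + + 1))
  twiceValue-2+1↦3 = solve-∀

  twiceValue-1+1↦2 : ∀ X Y Z W →
    twiceValueℤ X Y (+ 1 + Z) W ≡ twiceValueℤ X Y Z (+ 2 + W) + + 2 * ((X + Y) * (W + + 1))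
  twiceValue-1+1↦2 = solve-∀

  twiceValue-2+2↦3+1 : ∀ X Y Z W →
    twiceValueℤ X (+ 1 + Y) Z (+ 1 + W) ≡ twiceValueℤ X Y (+ 2 + Z) W + + 2 * ((Z + + 1) * (X + Y + Z + W + + 2))
  twiceValue-2+2↦3+1 = solve-∀

≤-of-gain : ∀ {i j} a b → j ≡ i + + 2 * (+ a * + b) → i ≤ℤ j
≤-of-gain {i} a b refl rewrite sym (pos-* a b) | sym (pos-* 2 (a ℕ.* b)) = i≤i+j i (+ (2 ℕ.* (a ℕ.* b)))

⟶-twiceValue : ∀ {s t} → s ⟶ t → twiceValue s ≤ℤ twiceValue t
⟶-twiceValue (2+1↦3 {x} {y} {z} {w}) =
  ≤-of-gain (x ℕ.+ y ℕ.+ z ℕ.+ 1) (z ℕ.+ w ℕ.+ 1) (twiceValue-2+1↦3 (+ x) (+ y) (+ z) (+ w))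
⟶-twiceValue (1+1↦2 {x} {y} {z} {w}) =
  ≤-of-gain (x ℕ.+ y) (w ℕ.+ 1) (twiceValue-1+1↦2 (+ x) (+ y) (+ z) (+ w))
⟶-twiceValue (2+2↦3+1 {x} {y} {z} {w}) =
  ≤-of-gain (z ℕ.+ 1) (x ℕ.+ y ℕ.+ z ℕ.+ w ℕ.+ 2) (twiceValue-2+2↦3+1 (+ x) (+ y) (+ z) (+ w))

⟶*-weight : ∀ {s t} → s ⟶* t → weight s ≡ weight t
⟶*-weight = fold (λ s t → weight s ≡ weight t) (λ s⟶u eq → trans (⟶-weight s⟶u) eq) refl

⟶*-size : ∀ {s t} → s ⟶* t → size t ≤ size s
⟶*-size = fold (λ s t → size t ≤ size s) (λ s⟶u le → ℕₚ.≤-trans le (⟶-size s⟶u)) ℕₚ.≤-refl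

⟶*-twiceValue : ∀ {s t} → s ⟶* t → twiceValue s ≤ℤ twiceValue t
⟶*-twiceValue = fold (λ s t → twiceValue s ≤ℤ twiceValue t) (λ s⟶u le → ≤-trans (⟶-twiceValue s⟶u) le) ≤-refl

-- Normal forms and the bound

data Reduced : Blocks → Set where
  no-small : ∀ {x y} → Reduced ⟨ x , y , 0 , 0 ⟩
  one-two  : ∀ {x y} → Reduced ⟨ x , y , 1 , 0 ⟩
  one-one  : ∀ {x y} → Reduced ⟨ x , y , 0 , 1 ⟩

NormalForm : Blocks → Set
NormalForm s = ∃[ t ] s ⟶* t × Reduced t

infixr 5 _◅ⁿᶠ_
_◅ⁿᶠ_ : ∀ {s u} → s ⟶ u → NormalForm u → NormalForm s
s⟶u ◅ⁿᶠ (t , u⟶*t , t-reduced) = t , s⟶u ◅ u⟶*t , t-reduced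

normalise₀ : ∀ x y z → NormalForm ⟨ x , y , z , 0 ⟩
normalise₁ : ∀ x y z → NormalForm ⟨ x , y , z , 1 ⟩

normalise₀ x y 0             = _ , ε , no-small
normalise₀ x y 1             = _ , ε , one-two
normalise₀ x y (suc (suc z)) = 2+2↦3+1 ◅ⁿᶠ normalise₁ x (suc y) z

normalise₁ x y 0       = _ , ε , one-one
normalise₁ x y (suc z) = 2+1↦3 ◅ⁿᶠ normalise₀ x (suc y) z

normalise : ∀ x y z w → NormalForm ⟨ x , y , z , w ⟩
normalise x y z 0             = normalise₀ x y z
normalise x y z 1             = normalise₁ x y z
normalise x y z (suc (suc w)) = 1+1↦2 ◅ⁿᶠ normalise x y (suc z) w

-- twiceBound q m unfolds to twiceCubic (+ q) (+ m) + twiceR₀ (+ q) (+ m).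
twiceCubic twiceR₁ twiceR₂ twiceR₃ : ℤ → ℤ → ℤ
twiceCubic q m = + 56 * q * q * q - + 45 * q * q * m + + 12 * q * m * m - m * m * m
twiceR₁ q m = + 3 * q * m - m * m - + 6 * q + + 2 * m
twiceR₂ q m = - (+ 56) * q * q + + 33 * q * m - + 5 * m * m + + 12 * q - + 4 * m
twiceR₃ q m = - (+ 112) * q * q + + 63 * q * m - + 9 * m * m + + 68 * q - + 20 * m - + 12
{-# INLINE twiceCubic #-}
{-# INLINE twiceR₁ #-}
{-# INLINE twiceR₂ #-}
{-# INLINE twiceR₃ #-}

opaque
  twiceValue-no-small : ∀ X Y → let q = X + Y + + 0 + + 0; m = + 4 * X + + 3 * Y + + 2 * + 0 + + 0 in
    twiceValueℤ X Y (+ 0) (+ 0) ≡ twiceCubic q m + twiceR₁ q m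
  twiceValue-no-small = solve-∀

  twiceValue-one-two : ∀ X Y → let q = X + Y + + 1 + + 0; m = + 4 * X + + 3 * Y + + 2 * + 1 + + 0 in
    twiceValueℤ X Y (+ 1) (+ 0) ≡ twiceCubic q m + twiceR₂ q m
  twiceValue-one-two = solve-∀

  twiceValue-one-one : ∀ X Y → let q = X + Y + + 0 + + 1; m = + 4 * X + + 3 * Y + + 2 * + 0 + + 1 in
    twiceValueℤ X Y (+ 0) (+ 1) ≡ twiceCubic q m + twiceR₃ q m
  twiceValue-one-one = solve-∀

twiceR₀ : ℤ → ℤ → ℤ
twiceR₀ q m = twiceR₁ q m ⊔ twiceR₂ q m ⊔ twiceR₃ q m
{-# INLINE twiceR₀ #-}

twiceR₁≤twiceR₀ : ∀ q m → twiceR₁ q m ≤ℤ twiceR₀ q m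
twiceR₁≤twiceR₀ q m = ≤-trans (i≤i⊔j (twiceR₁ q m) (twiceR₂ q m)) (i≤i⊔j _ (twiceR₃ q m))

twiceR₂≤twiceR₀ : ∀ q m → twiceR₂ q m ≤ℤ twiceR₀ q m
twiceR₂≤twiceR₀ q m = ≤-trans (i≤j⊔i (twiceR₁ q m) (twiceR₂ q m)) (i≤i⊔j _ (twiceR₃ q m))

twiceR₃≤twiceR₀ : ∀ q m → twiceR₃ q m ≤ℤ twiceR₀ q m
twiceR₃≤twiceR₀ q m = i≤j⊔i (twiceR₁ q m ⊔ twiceR₂ q m) (twiceR₃ q m)

≤-cubic+R₀ : ∀ q m {v r} → v ≡ twiceCubic q m + r → r ≤ℤ twiceR₀ q m → v ≤ℤ twiceCubic q m + twiceR₀ q m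
≤-cubic+R₀ q m refl r≤R₀ = +-monoʳ-≤ (twiceCubic q m) r≤R₀

reduced-twiceValue-≤ : ∀ {s} → Reduced s → twiceValue s ≤ℤ twiceBound (size s) (weight s)
reduced-twiceValue-≤ {s} s-reduced =
  subst (λ m → twiceValue s ≤ℤ twiceCubic (+ size s) m + twiceR₀ (+ size s) m)
        (sym (pos-weight s)) (bound s-reduced)
  where
  bound : ∀ {s} → Reduced s →
    twiceValue s ≤ℤ twiceCubic (+ size s) (weightℤ s) + twiceR₀ (+ size s) (weightℤ s)
  bound {s} (no-small {x} {y}) =
    ≤-cubic+R₀ (+ size s) (weightℤ s) (twiceValue-no-small (+ x) (+ y)) (twiceR₁≤twiceR₀ (+ size s) (weightℤ s))
  bound {s} (one-two {x} {y}) =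
    ≤-cubic+R₀ (+ size s) (weightℤ s) (twiceValue-one-two (+ x) (+ y)) (twiceR₂≤twiceR₀ (+ size s) (weightℤ s))
  bound {s} (one-one {x} {y}) =
    ≤-cubic+R₀ (+ size s) (weightℤ s) (twiceValue-one-one (+ x) (+ y)) (twiceR₃≤twiceR₀ (+ size s) (weightℤ s))

lemma4p2 : (m p : ℕ) (A : List ℕ) → Greedy m p A →
    Σ ℕ (λ q → q ≤ p × Σ (List ℕ) (λ A′ → Greedy m q A′ ×
      f m A ≤ℤ f m A′ × + 2 * f m A′ ≤ℤ twiceBound q m))
lemma4p2 m p A (length≡p , in-range , descending , sum≡m) with descending⇒block in-range descending
... | s , refl with normalise (fours s) (threes s) (twos s) (ones s)
... | t , s⟶*t , t-reduced = size t , size-t≤p , block t , greedy-t , f-s≤f-t , twice-f-t≤bound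
  where
  weight-s≡m : weight s ≡ m
  weight-s≡m = trans (sym (sum-block s)) sum≡m
  weight-t≡m : weight t ≡ m
  weight-t≡m = trans (sym (⟶*-weight s⟶*t)) weight-s≡m
  twice-f≡twiceValue : ∀ u → weight u ≡ m → + 2 * f m (block u) ≡ twiceValue u
  twice-f≡twiceValue u eq = subst (λ m → + 2 * f m (block u) ≡ twiceValue u) eq (twice-f-weight u)
  size-t≤p : size t ≤ p
  size-t≤p = ℕₚ.≤-trans (⟶*-size s⟶*t) (ℕₚ.≤-reflexive (trans (sym (length-block s)) length≡p))
  greedy-t : Greedy m (size t) (block t)
  greedy-t = subst (λ m → Greedy m (size t) (block t)) weight-t≡m (block-greedy t)
  f-s≤f-t : f m (block s) ≤ℤ f m (block t)
  f-s≤f-t = *-cancelˡ-≤-pos _ _ (+ 2)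
    (subst₂ _≤ℤ_ (sym (twice-f≡twiceValue s weight-s≡m)) (sym (twice-f≡twiceValue t weight-t≡m))
                 (⟶*-twiceValue s⟶*t))
  twice-f-t≤bound : + 2 * f m (block t) ≤ℤ twiceBound (size t) m
  twice-f-t≤bound = subst (λ m → + 2 * f m (block t) ≤ℤ twiceBound (size t) m) weight-t≡m
    (≤-trans (≤-reflexive (twice-f-weight t)) (reduced-twiceValue-≤ t-reduced))
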